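{- If $L_{\mathrm{co}}\ne l^\star$, then the restriction $(I_{\mathrm{co}},1,k)$ (constant functions $f_l\equiv1$, $f_u\equiv k$) is admissible, so in particular $l^\star\in\mathbf{C}(I_{\mathrm{co}},1,k)$. Furthermore, in the worst case $|\mathbf{C}(I_{\mathrm{co}},1,k)|=k\cdot\min(k-1,n)\in\Theta(k\cdot\min(k,n))$.
   Context: Let $\mathbf{L}=\{L_1,\dots,L_n\}$ be a multiset of positive rationals and $k\in\mathbb{N}_{>0}$. For $l\in\mathbb{Q}_{>0}$ let $m(l)=\sum_{i=1}^n\lfloor L_i/l\rfloor$; $l$ is feasible if $m(l)\ge k$. Let $l^\star=\max\{l\mid m(l)\ge k\}$. Let $L^{(r)}$ denote the $r$-th largest element of $\mathbf{L}$ (with multiplicity). Define $L_{\mathrm{co}}=L^{(k)}$ if $k\le n$ and $L_{\mathrm{co}}=0$ if $k>n$; when $L_{\mathrm{co}}\ne l^\star$ define $I_{\mathrm{co}}=\{i\in[1..n]\mid L_i>L_{\mathrm{co}}\}$. For $I\subseteq[1..n]$, $f_l:I\to\mathbb{N}$, $f_u:I\to\mathbb{N}\cup\{\infty\}$, let $\mathbf{C}(I,f_l,f_u)=\biguplus_{i\in I}\{L_i/j\mid f_l(i)\le j\le f_u(i)\}$. A triple $(I,f_l,f_u)$ is an admissible restriction if for all $i\in I$: $f_l(i)=1$ or $L_i/(f_l(i)-1)$ is infeasible; $L_i/f_u(i)$ is feasible; and for all $i'\notin I$, $L_{i'}$ is feasible and $L_{i'}\ne l^\star$. "Worst case" refers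 to the maximum over inputs with given $n$ and $k$. -}

module Defs where

open import Data.Nat as ℕ using (ℕ; zero; suc; _∸_)
open import Data.Integer as ℤ using (ℤ; +_)
open import Data.Rational as ℚ using (ℚ; 0ℚ; _÷_; _*_; floor; _<_; _≤_; ≢-nonZero)
open import Data.Rational.Properties using (_≟_; ≤-decTotalOrder)
open import Data.Fin using (Fin)
open import Data.List as List using (List; []; _∷_; allFin; filter; map; concatMap; reverse; foldr; length)
open import Data.Bool using (Bool; true; false; if_then_else_; T)
open import Data.Product using (_×_; ∃-syntax)
open import Data.Sum using (_⊎_)
open import Data.Unit using (⊤)
open import Relation.Nullary using (¬_; yes; no)
open import Relation.Binary.PropositionalEquality using (_≡_; _≢_)
import Data.List.Sort as Sort

-- Division of rationals, total: (p ÷? 0) = 0 (never used at 0 below,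
-- since feasibility requires l > 0).
_÷?_ : ℚ → ℚ → ℚ
p ÷? q with q ≟ 0ℚ
... | yes _ = 0ℚ
... | no q≢0 = _÷_ p q {{≢-nonZero q≢0}}

-- Division of a rational by a natural number j; L / 0 is set to 0
-- (which is infeasible, as feasibility requires positivity).
_/ℕ_ : ℚ → ℕ → ℚ
p /ℕ zero = 0ℚ
p /ℕ suc j = p * (+ 1 ℚ./ suc j)

Positive : {n : ℕ} → (Fin n → ℚ) → Set
Positive L = ∀ i → 0ℚ < L i

m : {n : ℕ} → (Fin n → ℚ) → ℚ → ℤ
m {n} L l = foldr ℤ._+_ (+ 0) (map (λ i → floor (L i ÷? l)) (allFin n))

Feasible : {n : ℕ} → (Fin n → ℚ) → ℕ → ℚ → Set
Feasible L k l = (0ℚ < l) × (+ k ℤ.≤ m L l)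

IsLStar : {n : ℕ} → (Fin n → ℚ) → ℕ → ℚ → Set
IsLStar L k l⋆ = Feasible L k l⋆ × (∀ l → Feasible L k l → l ≤ l⋆)

module QSort = Sort ≤-decTotalOrder

nth : List ℚ → ℕ → ℚ
nth [] _ = 0ℚ
nth (x ∷ xs) zero = x
nth (x ∷ xs) (suc r) = nth xs r

-- L^{(r)} for 1 ≤ r ≤ n: the r-th entry of the list sorted decreasingly
Largest : {n : ℕ} → (Fin n → ℚ) → ℕ → ℚ
Largest {n} L r = nth (reverse (QSort.sort (map L (allFin n)))) (r ∸ 1)

Lco : {n : ℕ} → (Fin n → ℚ) → ℕ → ℚ
Lco {n} L k with k ℕ.≤? n
... | yes _ = Largest L k
... | no _ = 0ℚ

Ico : {n : ℕ} → (Fin n → ℚ) → ℕ → Fin n → Bool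
Ico L k i with Lco L k ℚ.<? L i
... | yes _ = true
... | no _ = false

-- Upper bounds f_u take values in ℕ ∪ {∞}
data ℕ∞ : Set where
  fin : ℕ → ℕ∞
  ∞ : ℕ∞

Admissible : {n : ℕ} → (Fin n → ℚ) → ℕ →
             (Fin n → Bool) → (Fin n → ℕ) → (Fin n → ℕ∞) → Set
Admissible L k I fl fu =
  (∀ i → T (I i) →
     (fl i ≡ 1 ⊎ ((2 ℕ.≤ fl i) × ¬ Feasible L k (L i /ℕ (fl i ∸ 1))))
     × UpperOK (fu i) (L i))
  × (∀ i' → ¬ T (I i') → Feasible L k (L i') × (∀ l⋆ → IsLStar L k l⋆ → L i' ≢ l⋆))
  where
    UpperOK : ℕ∞ → ℚ → Set
    UpperOK (fin j) Li = Feasible L k (Li /ℕ j)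
    UpperOK ∞ Li = ⊤

-- [a..b]
range : ℕ → ℕ → List ℕ
range a b = List.map (a ℕ.+_) (List.upTo (suc b ∸ a))

-- C(I, f_l, f_u) for finite upper bounds, as a list (multiset)
C : {n : ℕ} → (Fin n → ℚ) → (Fin n → Bool) → (Fin n → ℕ) → (Fin n → ℕ) → List ℚ
C {n} L I fl fu =
  concatMap (λ i → map (λ j → L i /ℕ j) (range (fl i) (fu i)))
            (filter (λ i → T? (I i)) (allFin n))
  where
    open import Relation.Nullary.Decidable using () renaming (T? to T?)

-- The k-th largest length L_co is feasible, since at least k lengths are ≥ L_co; hence every length
-- outside I_co is feasible and, being ≤ L_co < l⋆, differs from l⋆. Each L_i / k is feasible as well.
-- The optimum l⋆ is an exact fraction L_i / j: otherwise l⋆ could be raised to the least of the values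
-- L_i / ⌊L_i / l⋆⌋ without decreasing any ⌊L_i / l⌋. Then j ≤ k because L_i / k ≤ l⋆, and
-- L_i ≥ l⋆ > L_co puts i into I_co. Finally |I_co| ≤ min(k − 1, n), as at most k − 1 lengths exceed
-- the k-th largest one; k − 1 lengths 1 and all others ¼ attain this bound.
module Submission where

open import Defs
open import Data.Nat using (ℕ; _≤_; _*_; _∸_; _⊓_)
open import Data.Rational using (ℚ)
open import Data.Fin using (Fin)
open import Data.List using (length)
open import Data.List.Membership.Propositional using (_∈_)
open import Data.Product using (_×_; ∃-syntax; _,_)
open import Relation.Binary.PropositionalEquality using (_≡_; _≢_)

open import Data.Bool using (Bool; true; false; T; if_then_else_)
open import Data.Empty using (⊥-elim)
open import Data.Fin as Fin using (toℕ)
import Data.Fin.Properties as Finₚ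
open import Data.Integer as ℤ using (ℤ; +_; -[1+_])
import Data.Integer.GCD as ℤ
import Data.Integer.Properties as ℤₚ
open import Data.List as List using (List; []; _∷_; _++_; [_]; map; allFin; filter; concatMap; reverse)
import Data.List.Properties as Listₚ
import Data.List.Membership.Propositional.Properties as ∈ₚ
open import Data.List.Relation.Unary.All as All using (All; []; _∷_)
import Data.List.Relation.Unary.All.Properties as Allₚ
open import Data.List.Relation.Unary.AllPairs using (AllPairs; []; _∷_)
open import Data.List.Relation.Unary.Any using (here; there)
import Data.List.Extrema
import Data.List.Relation.Unary.Linked.Properties as Linkedₚ
open import Data.List.Relation.Binary.Permutation.Propositional using (_↭_; refl; prep; swap; trans)
import Data.List.Relation.Binary.Permutation.Propositional.Properties as ↭ₚ
open import Data.Nat as ℕ using (zero; suc; z≤n; s≤s)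
open import Data.Nat.Coprimality as Coprime using ()
import Data.Nat.DivMod as ℕ
import Data.Nat.Properties as ℕₚ
open import Data.Product using (proj₁; proj₂)
open import Data.Rational as ℚ using (0ℚ; 1ℚ; mkℚ; ↥_; ↧_)
import Data.Rational.Properties as ℚₚ
open import Data.Sum using (_⊎_; inj₁; inj₂; [_,_]′)
open import Data.Unit using (tt)
open import Relation.Binary.Bundles using (DecTotalOrder)
open import Relation.Nullary using (¬_; yes; no; _×-dec_)
open import Relation.Nullary.Decidable using (isYes; T?; toWitness; fromWitness; toSum)
open import Relation.Binary.PropositionalEquality
  using (refl; sym; cong; cong₂; subst; subst₂; module ≡-Reasoning)
  renaming (trans to ≡-trans)

fromℕ : ℕ → ℚ
fromℕ j = mkℚ (+ j) 0 (Coprime.sym (Coprime.1-coprimeTo j))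

fromℕ-mono-≤ : ∀ {i j} → i ≤ j → fromℕ i ℚ.≤ fromℕ j
fromℕ-mono-≤ {i} {j} i≤j =
  ℚ.*≤* (subst₂ ℤ._≤_ (sym (ℤₚ.*-identityʳ (+ i))) (sym (ℤₚ.*-identityʳ (+ j))) (ℤ.+≤+ i≤j))

fromℕ-cancel-≤ : ∀ {i j} → fromℕ i ℚ.≤ fromℕ j → i ≤ j
fromℕ-cancel-≤ {i} {j} (ℚ.*≤* le)
  with subst₂ ℤ._≤_ (ℤₚ.*-identityʳ (+ i)) (ℤₚ.*-identityʳ (+ j)) le
... | ℤ.+≤+ i≤j = i≤j

fromℕ-suc-pos : ∀ j → 0ℚ ℚ.< fromℕ (suc j)
fromℕ-suc-pos j =
  ℚ.*<* (subst₂ ℤ._<_ (sym (ℤₚ.*-identityʳ (+ 0))) (sym (ℤₚ.*-identityʳ (+ suc j))) (ℤ.+<+ (s≤s z≤n)))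

private
  negative-not-nonNeg : ∀ a d .(c : Coprime.Coprime (suc a) (suc d)) → ¬ (0ℚ ℚ.≤ mkℚ -[1+ a ] d c)
  negative-not-nonNeg a d c (ℚ.*≤* le) =
    ℤₚ.<⇒≱ ℤ.-<+ (ℤₚ.≤-trans (ℤₚ.≤-reflexive (ℤₚ.*-identityʳ _))
                   (ℤₚ.≤-trans le (ℤₚ.≤-reflexive (ℤₚ.*-identityʳ -[1+ a ]))))

fromℕ≤⇒≤floor : ∀ j q → fromℕ j ℚ.≤ q → + j ℤ.≤ ℚ.floor q
fromℕ≤⇒≤floor j (mkℚ (+ a) d _) (ℚ.*≤* le) =
  subst (+ j ℤ.≤_) (sym (ℤₚ.*-identityˡ (+ (a ℕ./ suc d))))
    (ℤ.+≤+ (subst (ℕ._≤ a ℕ./ suc d) (ℕ.m*n/n≡m j (suc d))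
      (ℕ./-monoˡ-≤ (suc d) (subst (j * suc d ≤_) (ℕₚ.*-identityʳ a) j*d≤a*1))))
  where
  j*d≤a*1 : j * suc d ≤ a * 1
  j*d≤a*1 = ℤₚ.drop‿+≤+ (subst₂ ℤ._≤_ (sym (ℤₚ.pos-* j (suc d))) (sym (ℤₚ.pos-* a 1)) le)
fromℕ≤⇒≤floor j (mkℚ -[1+ a ] d c) j≤q =
  ⊥-elim (negative-not-nonNeg a d c (ℚₚ.≤-trans (fromℕ-mono-≤ z≤n) j≤q))

floor-nonNeg : ∀ q → 0ℚ ℚ.≤ q → + ℤ.∣ ℚ.floor q ∣ ≡ ℚ.floor q
floor-nonNeg (mkℚ (+ a) d _) _ =
  ≡-trans (cong (λ z → + ℤ.∣ z ∣) (ℤₚ.*-identityˡ (+ (a ℕ./ suc d))))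
          (sym (ℤₚ.*-identityˡ (+ (a ℕ./ suc d))))
floor-nonNeg (mkℚ -[1+ a ] d c) 0≤q = ⊥-elim (negative-not-nonNeg a d c 0≤q)

fromℕ∣floor∣≤ : ∀ q → 0ℚ ℚ.≤ q → fromℕ ℤ.∣ ℚ.floor q ∣ ℚ.≤ q
fromℕ∣floor∣≤ (mkℚ (+ a) d _) _ rewrite ℤₚ.*-identityˡ (+ (a ℕ./ suc d)) =
  ℚ.*≤* (subst₂ ℤ._≤_ (ℤₚ.pos-* (a ℕ./ suc d) (suc d)) (ℤₚ.pos-* a 1)
    (ℤ.+≤+ (ℕₚ.≤-trans (ℕ.m/n*n≤m a (suc d)) (ℕₚ.≤-reflexive (sym (ℕₚ.*-identityʳ a))))))
fromℕ∣floor∣≤ (mkℚ -[1+ a ] d c) 0≤q = ⊥-elim (negative-not-nonNeg a d c 0≤q)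

module _ {l : ℚ} (l>0 : 0ℚ ℚ.< l) where
  private instance
    l-positive : ℚ.Positive l
    l-positive = ℚ.positive l>0
    l-nonZero : ℚ.NonZero l
    l-nonZero = ℚₚ.pos⇒nonZero l
    l-nonNeg : ℚ.NonNegative l
    l-nonNeg = ℚₚ.pos⇒nonNeg l
    1/l-nonNeg : ℚ.NonNegative (ℚ.1/ l)
    1/l-nonNeg = ℚₚ.pos⇒nonNeg (ℚ.1/ l) {{ℚₚ.1/pos⇒pos l}}

  ÷?-≡ : ∀ x → x ÷? l ≡ x ℚ.* ℚ.1/ l
  ÷?-≡ x with l ℚₚ.≟ 0ℚ
  ... | yes l≡0 = ⊥-elim (ℚₚ.<-irrefl (sym l≡0) l>0)
  ... | no _ = refl

  ÷?-nonNeg : ∀ x → 0ℚ ℚ.≤ x → 0ℚ ℚ.≤ x ÷? l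
  ÷?-nonNeg x 0≤x =
    subst₂ ℚ._≤_ (ℚₚ.*-zeroˡ (ℚ.1/ l)) (sym (÷?-≡ x)) (ℚₚ.*-monoʳ-≤-nonNeg (ℚ.1/ l) 0≤x)

  fromℕ*≤⇒≤floor÷? : ∀ j x → fromℕ j ℚ.* l ℚ.≤ x → + j ℤ.≤ ℚ.floor (x ÷? l)
  fromℕ*≤⇒≤floor÷? j x jl≤x = fromℕ≤⇒≤floor j (x ÷? l) (begin
    fromℕ j                       ≡⟨ sym (ℚₚ.*-identityʳ (fromℕ j)) ⟩
    fromℕ j ℚ.* 1ℚ                ≡⟨ cong (fromℕ j ℚ.*_) (sym (ℚₚ.*-inverseʳ l)) ⟩
    fromℕ j ℚ.* (l ℚ.* ℚ.1/ l)    ≡⟨ sym (ℚₚ.*-assoc (fromℕ j) l (ℚ.1/ l)) ⟩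
    (fromℕ j ℚ.* l) ℚ.* ℚ.1/ l    ≤⟨ ℚₚ.*-monoʳ-≤-nonNeg (ℚ.1/ l) jl≤x ⟩
    x ℚ.* ℚ.1/ l                  ≡⟨ sym (÷?-≡ x) ⟩
    x ÷? l                        ∎)
    where open ℚₚ.≤-Reasoning

  fromℕ≤÷?⇒fromℕ*≤ : ∀ j x → fromℕ j ℚ.≤ x ÷? l → fromℕ j ℚ.* l ℚ.≤ x
  fromℕ≤÷?⇒fromℕ*≤ j x j≤x/l = begin
    fromℕ j ℚ.* l                 ≤⟨ ℚₚ.*-monoʳ-≤-nonNeg l j≤x/l ⟩
    (x ÷? l) ℚ.* l                ≡⟨ cong (ℚ._* l) (÷?-≡ x) ⟩
    (x ℚ.* ℚ.1/ l) ℚ.* l          ≡⟨ ℚₚ.*-assoc x (ℚ.1/ l) l ⟩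
    x ℚ.* (ℚ.1/ l ℚ.* l)          ≡⟨ cong (x ℚ.*_) (ℚₚ.*-inverseˡ l) ⟩
    x ℚ.* 1ℚ                      ≡⟨ ℚₚ.*-identityʳ x ⟩
    x                             ∎
    where open ℚₚ.≤-Reasoning

1/suc≡1/fromℕ : ∀ j → + 1 ℚ./ suc j ≡ ℚ.1/ fromℕ (suc j)
1/suc≡1/fromℕ j = ℚₚ.≃⇒≡ (ℚ.*≡* (cong₂ ℤ._*_ numerator (sym denominator)))
  where
  gcd≡1 : ℤ.gcd (+ 1) (+ suc j) ≡ + 1
  gcd≡1 = ℤ.gcd-zeroˡ (+ suc j)
  numerator : ↥ (+ 1 ℚ./ suc j) ≡ + 1
  numerator = ≡-trans (sym (ℤₚ.*-identityʳ _))
    (≡-trans (cong (↥ (+ 1 ℚ./ suc j) ℤ.*_) (sym gcd≡1)) (ℚₚ.↥-/ (+ 1) (suc j)))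
  denominator : ↧ (+ 1 ℚ./ suc j) ≡ + suc j
  denominator = ≡-trans (sym (ℤₚ.*-identityʳ _))
    (≡-trans (cong (↧ (+ 1 ℚ./ suc j) ℤ.*_) (sym gcd≡1)) (ℚₚ.↧-/ (+ 1) (suc j)))

module _ (j : ℕ) where
  private instance
    j+1-positive : ℚ.Positive (fromℕ (suc j))
    j+1-positive = ℚ.positive (fromℕ-suc-pos j)
    j+1-nonZero : ℚ.NonZero (fromℕ (suc j))
    j+1-nonZero = ℚₚ.pos⇒nonZero (fromℕ (suc j))
    j+1-nonNeg : ℚ.NonNegative (fromℕ (suc j))
    j+1-nonNeg = ℚₚ.pos⇒nonNeg (fromℕ (suc j))

  fromℕ*/ℕ-cancel : ∀ p → fromℕ (suc j) ℚ.* (p /ℕ suc j) ≡ p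
  fromℕ*/ℕ-cancel p = begin
    fromℕ (suc j) ℚ.* (p ℚ.* (+ 1 ℚ./ suc j))        ≡⟨ cong (λ z → fromℕ (suc j) ℚ.* (p ℚ.* z)) (1/suc≡1/fromℕ j) ⟩
    fromℕ (suc j) ℚ.* (p ℚ.* ℚ.1/ fromℕ (suc j))     ≡⟨ ℚₚ.*-comm (fromℕ (suc j)) (p ℚ.* ℚ.1/ fromℕ (suc j)) ⟩
    (p ℚ.* ℚ.1/ fromℕ (suc j)) ℚ.* fromℕ (suc j)     ≡⟨ ℚₚ.*-assoc p _ _ ⟩
    p ℚ.* (ℚ.1/ fromℕ (suc j) ℚ.* fromℕ (suc j))     ≡⟨ cong (p ℚ.*_) (ℚₚ.*-inverseˡ (fromℕ (suc j))) ⟩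
    p ℚ.* 1ℚ                                         ≡⟨ ℚₚ.*-identityʳ p ⟩
    p                                                ∎
    where open ≡-Reasoning

  fromℕ*-/ℕ-cancel : ∀ l → (fromℕ (suc j) ℚ.* l) /ℕ suc j ≡ l
  fromℕ*-/ℕ-cancel l = begin
    (fromℕ (suc j) ℚ.* l) ℚ.* (+ 1 ℚ./ suc j)        ≡⟨ cong ((fromℕ (suc j) ℚ.* l) ℚ.*_) (1/suc≡1/fromℕ j) ⟩
    (fromℕ (suc j) ℚ.* l) ℚ.* ℚ.1/ fromℕ (suc j)     ≡⟨ cong (ℚ._* ℚ.1/ fromℕ (suc j)) (ℚₚ.*-comm (fromℕ (suc j)) l) ⟩
    (l ℚ.* fromℕ (suc j)) ℚ.* ℚ.1/ fromℕ (suc j)     ≡⟨ ℚₚ.*-assoc l _ _ ⟩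
    l ℚ.* (fromℕ (suc j) ℚ.* ℚ.1/ fromℕ (suc j))     ≡⟨ cong (l ℚ.*_) (ℚₚ.*-inverseʳ (fromℕ (suc j))) ⟩
    l ℚ.* 1ℚ                                         ≡⟨ ℚₚ.*-identityʳ l ⟩
    l                                                ∎
    where open ≡-Reasoning

  ≤/ℕ⇒fromℕ*≤ : ∀ p l → l ℚ.≤ p /ℕ suc j → fromℕ (suc j) ℚ.* l ℚ.≤ p
  ≤/ℕ⇒fromℕ*≤ p l l≤p/j =
    subst (fromℕ (suc j) ℚ.* l ℚ.≤_) (fromℕ*/ℕ-cancel p) (ℚₚ.*-monoˡ-≤-nonNeg (fromℕ (suc j)) l≤p/j)

  /ℕ≤⇒≤fromℕ* : ∀ p l → p /ℕ suc j ℚ.≤ l → p ℚ.≤ fromℕ (suc j) ℚ.* l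
  /ℕ≤⇒≤fromℕ* p l p/j≤l =
    subst (ℚ._≤ fromℕ (suc j) ℚ.* l) (fromℕ*/ℕ-cancel p) (ℚₚ.*-monoˡ-≤-nonNeg (fromℕ (suc j)) p/j≤l)

  /ℕ-pos : ∀ p → 0ℚ ℚ.< p → 0ℚ ℚ.< p /ℕ suc j
  /ℕ-pos p p>0 = ℚₚ.*-cancelˡ-<-nonNeg (fromℕ (suc j))
    (subst₂ ℚ._<_ (sym (ℚₚ.*-zeroʳ (fromℕ (suc j)))) (sym (fromℕ*/ℕ-cancel p)) p>0)

indicator : Bool → ℕ
indicator true = 1
indicator false = 0

count : {A : Set} → (A → Bool) → List A → ℕ
count b [] = 0
count b (x ∷ xs) = indicator (b x) ℕ.+ count b xs

sumℤ : {A : Set} → (A → ℤ) → List A → ℤ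
sumℤ f xs = List.foldr ℤ._+_ (+ 0) (map f xs)

count-map : ∀ {A B : Set} (b : B → Bool) (f : A → B) xs → count b (map f xs) ≡ count (λ x → b (f x)) xs
count-map b f [] = refl
count-map b f (x ∷ xs) = cong (indicator (b (f x)) ℕ.+_) (count-map b f xs)

module _ {A : Set} where

  count-cong : ∀ (b b′ : A → Bool) xs → (∀ x → b x ≡ b′ x) → count b xs ≡ count b′ xs
  count-cong b b′ [] _ = refl
  count-cong b b′ (x ∷ xs) b≗b′ = cong₂ ℕ._+_ (cong indicator (b≗b′ x)) (count-cong b b′ xs b≗b′)

  count-mono : ∀ (b b′ : A → Bool) xs → (∀ x → T (b x) → T (b′ x)) → count b xs ≤ count b′ xs
  count-mono b b′ [] _ = z≤n
  count-mono b b′ (x ∷ xs) b⇒b′ = ℕₚ.+-mono-≤ (indicator-mono (b x) (b′ x) (b⇒b′ x)) (count-mono b b′ xs b⇒b′)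
    where
    indicator-mono : ∀ u v → (T u → T v) → indicator u ≤ indicator v
    indicator-mono false v _ = z≤n
    indicator-mono true true _ = s≤s z≤n
    indicator-mono true false u⇒v = ⊥-elim (u⇒v tt)

  count≤length : ∀ (b : A → Bool) xs → count b xs ≤ length xs
  count≤length b [] = z≤n
  count≤length b (x ∷ xs) = ℕₚ.+-mono-≤ (indicator≤1 (b x)) (count≤length b xs)
    where
    indicator≤1 : ∀ u → indicator u ≤ 1
    indicator≤1 true = s≤s z≤n
    indicator≤1 false = z≤n

  count-all : ∀ (b : A → Bool) xs → All (λ x → T (b x)) xs → count b xs ≡ length xs
  count-all b [] [] = refl
  count-all b (x ∷ xs) (bx ∷ bxs) with b x
  ... | true = cong suc (count-all b xs bxs)

  count-↭ : ∀ (b : A → Bool) {xs ys} → xs ↭ ys → count b xs ≡ count b ys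
  count-↭ b refl = refl
  count-↭ b (prep x p) = cong (indicator (b x) ℕ.+_) (count-↭ b p)
  count-↭ b (swap x y p) = begin
    indicator (b x) ℕ.+ (indicator (b y) ℕ.+ _)   ≡⟨ sym (ℕₚ.+-assoc (indicator (b x)) (indicator (b y)) _) ⟩
    (indicator (b x) ℕ.+ indicator (b y)) ℕ.+ _   ≡⟨ cong₂ ℕ._+_ (ℕₚ.+-comm (indicator (b x)) (indicator (b y))) (count-↭ b p) ⟩
    (indicator (b y) ℕ.+ indicator (b x)) ℕ.+ _   ≡⟨ ℕₚ.+-assoc (indicator (b y)) (indicator (b x)) _ ⟩
    indicator (b y) ℕ.+ (indicator (b x) ℕ.+ _)   ∎
    where open ≡-Reasoning
  count-↭ b (trans p q) = ≡-trans (count-↭ b p) (count-↭ b q)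

  length-filter≡count : ∀ (b : A → Bool) xs → length (filter (λ x → T? (b x)) xs) ≡ count b xs
  length-filter≡count b [] = refl
  length-filter≡count b (x ∷ xs) with b x
  ... | true = cong suc (length-filter≡count b xs)
  ... | false = length-filter≡count b xs

  sumℤ-mono-≤ : ∀ (f g : A → ℤ) xs → (∀ x → f x ℤ.≤ g x) → sumℤ f xs ℤ.≤ sumℤ g xs
  sumℤ-mono-≤ f g [] _ = ℤₚ.≤-refl
  sumℤ-mono-≤ f g (x ∷ xs) f≤g = ℤₚ.+-mono-≤ (f≤g x) (sumℤ-mono-≤ f g xs f≤g)

  sumℤ-nonNeg : ∀ (F : A → ℤ) xs → (∀ x → + 0 ℤ.≤ F x) → + 0 ℤ.≤ sumℤ F xs
  sumℤ-nonNeg F [] _ = ℤₚ.≤-refl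
  sumℤ-nonNeg F (x ∷ xs) 0≤F = ℤₚ.+-mono-≤ (0≤F x) (sumℤ-nonNeg F xs 0≤F)

  ≤sumℤ : ∀ (F : A → ℤ) {x} xs → (∀ y → + 0 ℤ.≤ F y) → x ∈ xs → F x ℤ.≤ sumℤ F xs
  ≤sumℤ F {x} (x ∷ xs) 0≤F (here refl) =
    subst (ℤ._≤ sumℤ F (x ∷ xs)) (ℤₚ.+-identityʳ (F x)) (ℤₚ.+-monoʳ-≤ (F x) (sumℤ-nonNeg F xs 0≤F))
  ≤sumℤ F (y ∷ xs) 0≤F (there x∈xs) =
    ℤₚ.≤-trans (≤sumℤ F xs 0≤F x∈xs)
      (subst (ℤ._≤ sumℤ F (y ∷ xs)) (ℤₚ.+-identityˡ (sumℤ F xs)) (ℤₚ.+-monoˡ-≤ (sumℤ F xs) (0≤F y)))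

  sumℤ-indicator : ∀ c (b : A → Bool) xs → sumℤ (λ x → + (c * indicator (b x))) xs ≡ + (c * count b xs)
  sumℤ-indicator c b [] = cong +_ (sym (ℕₚ.*-zeroʳ c))
  sumℤ-indicator c b (x ∷ xs) =
    ≡-trans (cong (λ s → + (c * indicator (b x)) ℤ.+ s) (sumℤ-indicator c b xs))
            (cong +_ (sym (ℕₚ.*-distribˡ-+ c (indicator (b x)) (count b xs))))

  *count≤sumℤ : ∀ c (b : A → Bool) (F : A → ℤ) xs →
    (∀ x → T (b x) → + c ℤ.≤ F x) → (∀ x → + 0 ℤ.≤ F x) → + (c * count b xs) ℤ.≤ sumℤ F xs
  *count≤sumℤ c b F xs c≤F 0≤F =
    subst (ℤ._≤ sumℤ F xs) (sumℤ-indicator c b xs) (sumℤ-mono-≤ _ F xs pointwise)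
    where
    pointwise : ∀ x → + (c * indicator (b x)) ℤ.≤ F x
    pointwise x with b x | c≤F x
    ... | true | c≤Fx = subst (λ z → + z ℤ.≤ F x) (sym (ℕₚ.*-identityʳ c)) (c≤Fx tt)
    ... | false | _ = subst (λ z → + z ℤ.≤ F x) (sym (ℕₚ.*-zeroʳ c)) (0≤F x)

atLeast above : ℚ → ℚ → Bool
atLeast y x = isYes (y ℚ.≤? x)
above y x = isYes (y ℚ.<? x)

atLeast-refl : ∀ x → atLeast x x ≡ true
atLeast-refl x with x ℚ.≤? x
... | yes _ = refl
... | no x≰x = ⊥-elim (x≰x ℚₚ.≤-refl)

above-false : ∀ {y x} → x ℚ.≤ y → above y x ≡ false
above-false {y} {x} x≤y with y ℚ.<? x
... | yes y<x = ⊥-elim (ℚₚ.<-irrefl refl (ℚₚ.<-≤-trans y<x x≤y))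
... | no _ = refl

nth-++-< : ∀ ys zs r → r ℕ.< length ys → nth (ys ++ zs) r ≡ nth ys r
nth-++-< (y ∷ ys) zs zero _ = refl
nth-++-< (y ∷ ys) zs (suc r) (s≤s r<ys) = nth-++-< ys zs r r<ys

nth-++-length : ∀ ys x zs → nth (ys ++ x ∷ zs) (length ys) ≡ x
nth-++-length [] x zs = refl
nth-++-length (y ∷ ys) x zs = nth-++-length ys x zs

nth-reverse-∷-< : ∀ x xs r → r ℕ.< length xs → nth (reverse (x ∷ xs)) r ≡ nth (reverse xs) r
nth-reverse-∷-< x xs r r<xs =
  ≡-trans (cong (λ z → nth z r) (Listₚ.unfold-reverse x xs))
          (nth-++-< (reverse xs) [ x ] r (subst (r ℕ.<_) (sym (Listₚ.length-reverse xs)) r<xs))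

nth-reverse-∷-length : ∀ x xs → nth (reverse (x ∷ xs)) (length xs) ≡ x
nth-reverse-∷-length x xs =
  ≡-trans (cong (λ z → nth z (length xs)) (Listₚ.unfold-reverse x xs))
          (subst (λ r → nth (reverse xs ++ [ x ]) r ≡ x) (Listₚ.length-reverse xs) (nth-++-length (reverse xs) x []))

record OrderStatistic (y : ℚ) (r : ℕ) (t : List ℚ) : Set where
  field
    member : y ∈ t
    atLeast-count : suc r ≤ count (atLeast y) t
    above-count : count (above y) t ≤ r

nth-reverse-sorted : ∀ t → AllPairs ℚ._≤_ t → ∀ r → r ℕ.< length t → OrderStatistic (nth (reverse t) r) r t
nth-reverse-sorted (x ∷ xs) (x≤xs ∷ sorted) r (s≤s r≤xs) with ℕₚ.m≤n⇒m<n∨m≡n r≤xs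
... | inj₁ r<xs = subst (λ y → OrderStatistic y r (x ∷ xs)) (sym (nth-reverse-∷-< x xs r r<xs)) (record
  { member = there member
  ; atLeast-count = ℕₚ.≤-trans atLeast-count (ℕₚ.m≤n+m _ (indicator (atLeast y x)))
  ; above-count = subst (λ z → indicator z ℕ.+ count (above y) xs ≤ r) (sym (above-false x≤y)) above-count
  })
  where
  open OrderStatistic (nth-reverse-sorted xs sorted r r<xs)
  y = nth (reverse xs) r
  x≤y : x ℚ.≤ y
  x≤y = All.lookup x≤xs member
... | inj₂ refl = subst (λ y → OrderStatistic y r (x ∷ xs)) (sym (nth-reverse-∷-length x xs)) (record
  { member = here refl
  ; atLeast-count = subst (λ z → suc r ≤ indicator z ℕ.+ count (atLeast x) xs) (sym (atLeast-refl x))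
      (s≤s (ℕₚ.≤-reflexive (sym (count-all (atLeast x) xs (All.map fromWitness x≤xs)))))
  ; above-count = subst (λ z → indicator z ℕ.+ count (above x) xs ≤ r) (sym (above-false ℚₚ.≤-refl))
      (count≤length (above x) xs)
  })

lengths : ∀ {n} → (Fin n → ℚ) → List ℚ
lengths {n} L = map L (allFin n)

length-lengths : ∀ {n} (L : Fin n → ℚ) → length (lengths L) ≡ n
length-lengths {n} L = ≡-trans (Listₚ.length-map L (allFin n)) (Listₚ.length-tabulate (λ i → i))

module _ {n : ℕ} (L : Fin n → ℚ) (k : ℕ) where

  Lco-≤ : k ≤ n → Lco L k ≡ Largest L k
  Lco-≤ k≤n with k ℕ.≤? n
  ... | yes _ = refl
  ... | no k≰n = ⊥-elim (k≰n k≤n)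

  Lco-> : ¬ k ≤ n → Lco L k ≡ 0ℚ
  Lco-> k≰n with k ℕ.≤? n
  ... | yes k≤n = ⊥-elim (k≰n k≤n)
  ... | no _ = refl

  Ico≡above : ∀ i → Ico L k i ≡ above (Lco L k) (L i)
  Ico≡above i with Lco L k ℚ.<? L i
  ... | yes _ = refl
  ... | no _ = refl

  record KthLargest (y : ℚ) : Set where
    field
      index : Fin n
      is-length : y ≡ L index
      atLeast-count : k ≤ count (atLeast y) (lengths L)
      above-count : count (above y) (lengths L) ≤ k ∸ 1

  Lco-kthLargest : 1 ≤ k → k ≤ n → KthLargest (Lco L k)
  Lco-kthLargest 1≤k k≤n = subst KthLargest (sym (Lco-≤ k≤n)) (record
    { index = proj₁ L⁻¹y
    ; is-length = proj₂ (proj₂ L⁻¹y)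
    ; atLeast-count = subst₂ _≤_ (≡-trans (ℕₚ.+-comm 1 (k ∸ 1)) (ℕₚ.m∸n+n≡m 1≤k)) (count-↭ (atLeast y) sorted↭)
        (OrderStatistic.atLeast-count stat)
    ; above-count = subst (_≤ k ∸ 1) (count-↭ (above y) sorted↭) (OrderStatistic.above-count stat)
    })
    where
    open QSort using (sort; sort-↭; sort-↗)
    sorted↭ : sort (lengths L) ↭ lengths L
    sorted↭ = sort-↭ (lengths L)
    k-1<length : k ∸ 1 ℕ.< length (sort (lengths L))
    k-1<length = subst (k ∸ 1 ℕ.<_) (sym (≡-trans (↭ₚ.↭-length sorted↭) (length-lengths L)))
                   (ℕₚ.<-≤-trans (ℕₚ.∸-monoʳ-< {k} {1} {0} (s≤s z≤n) 1≤k) k≤n)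
    stat = nth-reverse-sorted (sort (lengths L))
             (Linkedₚ.Linked⇒AllPairs ℚₚ.≤-trans (sort-↗ (lengths L))) (k ∸ 1) k-1<length
    y = nth (reverse (sort (lengths L))) (k ∸ 1)
    L⁻¹y = ∈ₚ.∈-map⁻ L (↭ₚ.Any-resp-↭ sorted↭ (OrderStatistic.member stat))

module _ {n : ℕ} {L : Fin n → ℚ} (L>0 : Positive L) where

  floor÷?-nonNeg : ∀ {l} → 0ℚ ℚ.< l → ∀ i → + 0 ℤ.≤ ℚ.floor (L i ÷? l)
  floor÷?-nonNeg {l} l>0 i =
    fromℕ*≤⇒≤floor÷? l>0 0 (L i) (subst (ℚ._≤ L i) (sym (ℚₚ.*-zeroˡ l)) (ℚₚ.<⇒≤ (L>0 i)))

  count-atLeast≤m : ∀ {l} → 0ℚ ℚ.< l → + count (atLeast l) (lengths L) ℤ.≤ m L l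
  count-atLeast≤m {l} l>0 =
    subst (ℤ._≤ m L l) (cong +_ (≡-trans (ℕₚ.*-identityˡ _) (sym (count-map (atLeast l) L (allFin n)))))
      (*count≤sumℤ 1 (λ i → atLeast l (L i)) (λ i → ℚ.floor (L i ÷? l)) (allFin n) 1≤floor (floor÷?-nonNeg l>0))
    where
    1≤floor : ∀ i → T (atLeast l (L i)) → + 1 ℤ.≤ ℚ.floor (L i ÷? l)
    1≤floor i l≤Li = fromℕ*≤⇒≤floor÷? l>0 1 (L i) (subst (ℚ._≤ L i) (sym (ℚₚ.*-identityˡ l)) (toWitness l≤Li))

  feasible-if-count : ∀ {k l} → 0ℚ ℚ.< l → k ≤ count (atLeast l) (lengths L) → Feasible L k l
  feasible-if-count l>0 k≤count = l>0 , ℤₚ.≤-trans (ℤ.+≤+ k≤count) (count-atLeast≤m l>0)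

  ≤kthLargest⇒feasible : ∀ {k y l} → KthLargest L k y → 0ℚ ℚ.< l → l ℚ.≤ y → Feasible L k l
  ≤kthLargest⇒feasible {k} {y} kth l>0 l≤y = feasible-if-count l>0
    (ℕₚ.≤-trans atLeast-count (count-mono _ _ (lengths L) (λ x y≤x → fromWitness (ℚₚ.≤-trans l≤y (toWitness y≤x)))))
    where open KthLargest kth

  kthLargest-feasible : ∀ {k y} → KthLargest L k y → Feasible L k y
  kthLargest-feasible kth = ≤kthLargest⇒feasible kth (subst (0ℚ ℚ.<_) (sym is-length) (L>0 index)) ℚₚ.≤-refl
    where open KthLargest kth

  /ℕ-feasible : ∀ {k} → 1 ≤ k → ∀ i → Feasible L k (L i /ℕ k)
  /ℕ-feasible {suc k} _ i = Li/k>0 , ℤₚ.≤-trans k≤floor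
    (≤sumℤ (λ j → ℚ.floor (L j ÷? (L i /ℕ suc k))) (allFin n) (floor÷?-nonNeg Li/k>0) (∈ₚ.∈-allFin i))
    where
    Li/k>0 = /ℕ-pos k (L i) (L>0 i)
    k≤floor : + suc k ℤ.≤ ℚ.floor (L i ÷? (L i /ℕ suc k))
    k≤floor = fromℕ*≤⇒≤floor÷? Li/k>0 (suc k) (L i) (ℚₚ.≤-reflexive (fromℕ*/ℕ-cancel k (L i)))

-- The optimum is attained at an exact fraction of some length

module _ {n : ℕ} {L : Fin n → ℚ} {k : ℕ} (L>0 : Positive L) {l⋆ : ℚ} (l⋆-max : IsLStar L k l⋆) where
  private
    open Data.List.Extrema (DecTotalOrder.totalOrder ℚₚ.≤-decTotalOrder)
      using (min; min≤xs; argmin-sel)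

    l⋆>0 : 0ℚ ℚ.< l⋆
    l⋆>0 = proj₁ (proj₁ l⋆-max)

    instance
      l⋆-positive : ℚ.Positive l⋆
      l⋆-positive = ℚ.positive l⋆>0

    parts : Fin n → ℕ
    parts i = ℤ.∣ ℚ.floor (L i ÷? l⋆) ∣

    parts*l⋆≤L : ∀ i → fromℕ (parts i) ℚ.* l⋆ ℚ.≤ L i
    parts*l⋆≤L i = fromℕ≤÷?⇒fromℕ*≤ l⋆>0 (parts i) (L i)
      (fromℕ∣floor∣≤ (L i ÷? l⋆) (÷?-nonNeg l⋆>0 (L i) (ℚₚ.<⇒≤ (L>0 i))))

    -- the largest l with ⌊x / l⌋ ≥ j; for j = 0 any l works, and 2 l⋆ is an arbitrary value above l⋆
    limit : ℕ → ℚ → ℚ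
    limit zero _ = fromℕ 2 ℚ.* l⋆
    limit (suc j) x = x /ℕ suc j

    l⋆<2l⋆ : l⋆ ℚ.< fromℕ 2 ℚ.* l⋆
    l⋆<2l⋆ = subst (ℚ._< fromℕ 2 ℚ.* l⋆) (ℚₚ.*-identityˡ l⋆)
      (ℚₚ.*-monoˡ-<-pos l⋆ {fromℕ 1} {fromℕ 2} (ℚ.*<* (ℤ.+<+ (s≤s (s≤s z≤n)))))

    l⋆<limit : ∀ x j → fromℕ j ℚ.* l⋆ ℚ.≤ x → (1 ≤ j → x ≢ fromℕ j ℚ.* l⋆) → l⋆ ℚ.< limit j x
    l⋆<limit x zero _ _ = l⋆<2l⋆
    l⋆<limit x (suc j) jl⋆≤x x≢jl⋆ =
      ℚₚ.≰⇒> (λ x/j≤l⋆ → x≢jl⋆ (s≤s z≤n) (ℚₚ.≤-antisym (/ℕ≤⇒≤fromℕ* j x l⋆ x/j≤l⋆) jl⋆≤x))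

    limits : List ℚ
    limits = map (λ i → limit (parts i) (L i)) (allFin n)

    raised : ℚ
    raised = min (fromℕ 2 ℚ.* l⋆) limits

    raised≤limit : ∀ i → raised ℚ.≤ limit (parts i) (L i)
    raised≤limit i = All.lookup (min≤xs (fromℕ 2 ℚ.* l⋆) limits) (∈ₚ.∈-map⁺ _ (∈ₚ.∈-allFin i))

    l⋆<raised : (∀ i → l⋆ ℚ.< limit (parts i) (L i)) → l⋆ ℚ.< raised
    l⋆<raised l⋆<limits with argmin-sel (λ x → x) (fromℕ 2 ℚ.* l⋆) limits
    ... | inj₁ raised≡2l⋆ = subst (l⋆ ℚ.<_) (sym raised≡2l⋆) l⋆<2l⋆
    ... | inj₂ raised∈limits with ∈ₚ.∈-map⁻ _ raised∈limits
    ...   | i , _ , raised≡limit = subst (l⋆ ℚ.<_) (sym raised≡limit) (l⋆<limits i)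

    parts≤floor÷? : ∀ {l} → 0ℚ ℚ.< l → ∀ i → l ℚ.≤ limit (parts i) (L i) → + parts i ℤ.≤ ℚ.floor (L i ÷? l)
    parts≤floor÷? {l} l>0 i l≤limit with parts i
    ... | zero = floor÷?-nonNeg L>0 l>0 i
    ... | suc j = fromℕ*≤⇒≤floor÷? l>0 (suc j) (L i) (≤/ℕ⇒fromℕ*≤ j (L i) l l≤limit)

    raised-feasible : l⋆ ℚ.< raised → Feasible L k raised
    raised-feasible l⋆<raised =
      raised>0 , ℤₚ.≤-trans (proj₂ (proj₁ l⋆-max)) (sumℤ-mono-≤ _ _ (allFin n) floor≤floor)
      where
      raised>0 = ℚₚ.<-trans l⋆>0 l⋆<raised
      floor≤floor : ∀ i → ℚ.floor (L i ÷? l⋆) ℤ.≤ ℚ.floor (L i ÷? raised)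
      floor≤floor i = subst (ℤ._≤ ℚ.floor (L i ÷? raised))
        (floor-nonNeg _ (÷?-nonNeg l⋆>0 (L i) (ℚₚ.<⇒≤ (L>0 i))))
        (parts≤floor÷? raised>0 i (raised≤limit i))

  l⋆-divides-some-length : ∃[ i ] ∃[ j ] (1 ≤ j × L i ≡ fromℕ j ℚ.* l⋆)
  l⋆-divides-some-length with Finₚ.any? (λ i → (1 ℕ.≤? parts i) ×-dec (L i ℚₚ.≟ fromℕ (parts i) ℚ.* l⋆))
  ... | yes (i , 1≤j , Li≡jl⋆) = i , parts i , 1≤j , Li≡jl⋆
  ... | no none = ⊥-elim (ℚₚ.<-irrefl refl (ℚₚ.<-≤-trans l⋆<r (proj₂ l⋆-max raised (raised-feasible l⋆<r))))
    where
    l⋆<r : l⋆ ℚ.< raised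
    l⋆<r = l⋆<raised (λ i → l⋆<limit (L i) (parts i) (parts*l⋆≤L i)
                                        (λ 1≤j Li≡jl⋆ → none (i , 1≤j , Li≡jl⋆)))

-- Admissibility of (I_co, 1, k) and l⋆ ∈ C(I_co, 1, k)

∈-range : ∀ {a b j} → a ≤ j → j ≤ b → j ∈ range a b
∈-range {a} {b} {j} a≤j j≤b = subst (_∈ range a b) (ℕₚ.m+[n∸m]≡n a≤j)
  (∈ₚ.∈-map⁺ (a ℕ.+_) (∈ₚ.∈-upTo⁺ (ℕₚ.∸-monoˡ-< (s≤s j≤b) a≤j)))

∈-C : ∀ {n} (L : Fin n → ℚ) I fl fu {i j} → T (I i) → fl i ≤ j → j ≤ fu i → L i /ℕ j ∈ C L I fl fu
∈-C {n} L I fl fu {i} i∈I fl≤j j≤fu = ∈ₚ.∈-concat⁺′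
  (∈ₚ.∈-map⁺ (L i /ℕ_) (∈-range fl≤j j≤fu))
  (∈ₚ.∈-map⁺ (λ i → map (L i /ℕ_) (range (fl i) (fu i)))
             (∈ₚ.∈-filter⁺ (λ i → T? (I i)) (∈ₚ.∈-allFin i) i∈I))

IsLStar-unique : ∀ {n} {L : Fin n → ℚ} {k l₁ l₂} → IsLStar L k l₁ → IsLStar L k l₂ → l₁ ≡ l₂
IsLStar-unique l₁-max l₂-max =
  ℚₚ.≤-antisym (proj₂ l₂-max _ (proj₁ l₁-max)) (proj₂ l₁-max _ (proj₁ l₂-max))

multiplicity≤k : ∀ {n} {L : Fin n → ℚ} {k l⋆} → 1 ≤ k → Positive L → IsLStar L k l⋆ →
                 ∀ {i j} → L i ≡ fromℕ j ℚ.* l⋆ → j ≤ k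
multiplicity≤k {L = L} {k = suc k} {l⋆} 1≤k L>0 l⋆-max {i} {j} Li≡jl⋆ =
  fromℕ-cancel-≤ (ℚₚ.*-cancelʳ-≤-pos l⋆ {{ℚ.positive (proj₁ (proj₁ l⋆-max))}}
    (subst (ℚ._≤ fromℕ (suc k) ℚ.* l⋆) Li≡jl⋆
      (/ℕ≤⇒≤fromℕ* k (L i) l⋆ (proj₂ l⋆-max _ (/ℕ-feasible L>0 1≤k i)))))

module _ {n : ℕ} {L : Fin n → ℚ} {k : ℕ} (1≤k : 1 ≤ k) (L>0 : Positive L)
         {l⋆ : ℚ} (l⋆-max : IsLStar L k l⋆) (Lco≢l⋆ : Lco L k ≢ l⋆) where

  Lco<l⋆ : Lco L k ℚ.< l⋆
  Lco<l⋆ = [ (λ k≤n → ℚₚ.≰⇒> (λ l⋆≤Lco → Lco≢l⋆ (ℚₚ.≤-antisym (Lco≤l⋆ k≤n) l⋆≤Lco)))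
           , (λ k≰n → subst (ℚ._< l⋆) (sym (Lco-> L k k≰n)) (proj₁ (proj₁ l⋆-max))) ]′ (toSum (k ℕ.≤? n))
    where
    Lco≤l⋆ : k ≤ n → Lco L k ℚ.≤ l⋆
    Lco≤l⋆ k≤n = proj₂ l⋆-max _ (kthLargest-feasible L>0 (Lco-kthLargest L k 1≤k k≤n))

  private
    ∉Ico⇒≤Lco : ∀ {i} → ¬ T (Ico L k i) → L i ℚ.≤ Lco L k
    ∉Ico⇒≤Lco {i} i∉I = ℚₚ.≮⇒≥ (λ Lco<Li → i∉I (subst T (sym (Ico≡above L k i)) (fromWitness Lco<Li)))

    ∉Ico⇒feasible : ∀ {i} → ¬ T (Ico L k i) → Feasible L k (L i)
    ∉Ico⇒feasible {i} i∉I =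
      [ (λ k≤n → ≤kthLargest⇒feasible L>0 (Lco-kthLargest L k 1≤k k≤n) (L>0 i) (∉Ico⇒≤Lco i∉I))
      , (λ k≰n → ⊥-elim (ℚₚ.<-irrefl refl
          (ℚₚ.<-≤-trans (L>0 i) (subst (L i ℚ.≤_) (Lco-> L k k≰n) (∉Ico⇒≤Lco i∉I)))))
      ]′ (toSum (k ℕ.≤? n))

  Ico-admissible : Admissible L k (Ico L k) (λ _ → 1) (λ _ → fin k)
  Ico-admissible = (λ i _ → inj₁ refl , /ℕ-feasible L>0 1≤k i)
                 , λ i i∉I → ∉Ico⇒feasible i∉I
                   , λ l l-max Li≡l → ℚₚ.<-irrefl (≡-trans Li≡l (IsLStar-unique {L = L} l-max l⋆-max))
                       (ℚₚ.≤-<-trans (∉Ico⇒≤Lco {i} i∉I) Lco<l⋆)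

  l⋆∈C : l⋆ ∈ C L (Ico L k) (λ _ → 1) (λ _ → k)
  l⋆∈C with l⋆-divides-some-length L>0 l⋆-max
  ... | i , suc j , _ , Li≡jl⋆ =
    subst (_∈ C L (Ico L k) (λ _ → 1) (λ _ → k)) (≡-trans (cong (_/ℕ suc j) Li≡jl⋆) (fromℕ*-/ℕ-cancel j l⋆))
      (∈-C L (Ico L k) _ _ i∈Ico (s≤s z≤n) (multiplicity≤k 1≤k L>0 l⋆-max Li≡jl⋆))
    where
    l⋆≤Li : l⋆ ℚ.≤ L i
    l⋆≤Li = subst₂ ℚ._≤_ (ℚₚ.*-identityˡ l⋆) (sym Li≡jl⋆)
      (ℚₚ.*-monoʳ-≤-nonNeg l⋆ {{ℚₚ.pos⇒nonNeg l⋆ {{ℚ.positive (proj₁ (proj₁ l⋆-max))}}}}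
        (fromℕ-mono-≤ (s≤s z≤n)))
    i∈Ico : T (Ico L k i)
    i∈Ico = subst T (sym (Ico≡above L k i)) (fromWitness (ℚₚ.<-≤-trans Lco<l⋆ l⋆≤Li))

-- The size of C(I_co, 1, k)

length-range : ∀ a b → length (range a b) ≡ suc b ∸ a
length-range a b = ≡-trans (Listₚ.length-map (a ℕ.+_) (List.upTo (suc b ∸ a))) (Listₚ.length-upTo (suc b ∸ a))

length-C-const : ∀ {n} (L : Fin n → ℚ) I a b →
                 length (C L I (λ _ → a) (λ _ → b)) ≡ (suc b ∸ a) * count I (allFin n)
length-C-const {n} L I a b =
  ≡-trans (length-blocks (filter (λ i → T? (I i)) (allFin n)))
          (cong ((suc b ∸ a) *_) (length-filter≡count I (allFin n)))
  where
  length-blocks : ∀ is → length (concatMap (λ i → map (L i /ℕ_) (range a b)) is) ≡ (suc b ∸ a) * length is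
  length-blocks [] = sym (ℕₚ.*-zeroʳ (suc b ∸ a))
  length-blocks (i ∷ is) = begin
    length (map (L i /ℕ_) (range a b) ++ concatMap (λ i → map (L i /ℕ_) (range a b)) is)
      ≡⟨ Listₚ.length-++ (map (L i /ℕ_) (range a b)) ⟩
    length (map (L i /ℕ_) (range a b)) ℕ.+ length (concatMap (λ i → map (L i /ℕ_) (range a b)) is)
      ≡⟨ cong₂ ℕ._+_ (≡-trans (Listₚ.length-map (L i /ℕ_) (range a b)) (length-range a b)) (length-blocks is) ⟩
    (suc b ∸ a) ℕ.+ (suc b ∸ a) * length is
      ≡⟨ sym (ℕₚ.*-suc (suc b ∸ a) (length is)) ⟩
    (suc b ∸ a) * suc (length is)
      ∎
    where open ≡-Reasoning

count-Ico : ∀ {n} (L : Fin n → ℚ) k → count (Ico L k) (allFin n) ≡ count (above (Lco L k)) (lengths L)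
count-Ico {n} L k = ≡-trans (count-cong _ _ (allFin n) (Ico≡above L k)) (sym (count-map (above (Lco L k)) L (allFin n)))

count-Ico≤ : ∀ {n} (L : Fin n → ℚ) k → 1 ≤ k → count (Ico L k) (allFin n) ≤ (k ∸ 1) ⊓ n
count-Ico≤ {n} L k 1≤k = subst (_≤ (k ∸ 1) ⊓ n) (sym (count-Ico L k)) (ℕₚ.⊓-glb ≤k-1 ≤n)
  where
  ≤n : count (above (Lco L k)) (lengths L) ≤ n
  ≤n = subst (count (above (Lco L k)) (lengths L) ≤_) (length-lengths L) (count≤length _ (lengths L))
  ≤k-1 : count (above (Lco L k)) (lengths L) ≤ k ∸ 1
  ≤k-1 = [ (λ k≤n → KthLargest.above-count (Lco-kthLargest L k 1≤k k≤n))
         , (λ k≰n → ℕₚ.≤-trans ≤n (ℕₚ.<⇒≤pred (ℕₚ.≰⇒> k≰n))) ]′ (toSum (k ℕ.≤? n))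

length-C-Ico≤ : ∀ {n} (L : Fin n → ℚ) k → 1 ≤ k → length (C L (Ico L k) (λ _ → 1) (λ _ → k)) ≤ k * ((k ∸ 1) ⊓ n)
length-C-Ico≤ L k 1≤k = subst (_≤ _) (sym (length-C-const L (Ico L k) 1 k)) (ℕₚ.*-monoʳ-≤ k (count-Ico≤ L k 1≤k))

-- Worst case

k≤2*[k∸1] : ∀ {k} → 2 ≤ k → k ≤ 2 * (k ∸ 1)
k≤2*[k∸1] {suc zero} (s≤s ())
k≤2*[k∸1] {suc (suc k)} _ = s≤s (subst (suc k ≤_) (sym (ℕₚ.+-suc k (k ℕ.+ 0))) (s≤s (ℕₚ.m≤m+n k (k ℕ.+ 0))))

count-allFin-suc : ∀ n (b : Fin (suc n) → Bool) →
                   count b (allFin (suc n)) ≡ indicator (b Fin.zero) ℕ.+ count (λ i → b (Fin.suc i)) (allFin n)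
count-allFin-suc n b = cong (indicator (b Fin.zero) ℕ.+_)
  (≡-trans (cong (count b) (sym (Listₚ.map-tabulate (λ i → i) Fin.suc))) (count-map b Fin.suc (allFin n)))

count-toℕ< : ∀ n a → count (λ (i : Fin n) → toℕ i ℕ.<ᵇ a) (allFin n) ≡ a ⊓ n
count-toℕ< zero a = sym (ℕₚ.⊓-zeroʳ a)
count-toℕ< (suc n) zero = ≡-trans (count-allFin-suc n (λ i → toℕ i ℕ.<ᵇ 0)) (count-toℕ< n zero)
count-toℕ< (suc n) (suc a) = ≡-trans (count-allFin-suc n (λ i → toℕ i ℕ.<ᵇ suc a)) (cong suc (count-toℕ< n a))

module WorstCase (n k : ℕ) (2≤k : 2 ≤ k) where

  ¼ ½ : ℚ
  ¼ = + 1 ℚ./ 4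
  ½ = + 1 ℚ./ 2

  long : Fin n → Bool
  long i = toℕ i ℕ.<ᵇ (k ∸ 1)

  L : Fin n → ℚ
  L i = if long i then 1ℚ else ¼

  1≤k : 1 ≤ k
  1≤k = ℕₚ.≤-trans (s≤s z≤n) 2≤k

  L>0 : Positive L
  L>0 i with long i
  ... | true = toWitness {a? = 0ℚ ℚ.<? 1ℚ} tt
  ... | false = toWitness {a? = 0ℚ ℚ.<? ¼} tt

  count-long : count long (allFin n) ≡ (k ∸ 1) ⊓ n
  count-long = count-toℕ< n (k ∸ 1)

  count-separating : ∀ (b : ℚ → Bool) → b 1ℚ ≡ true → b ¼ ≡ false → count b (lengths L) ≡ (k ∸ 1) ⊓ n
  count-separating b b1 b¼ =
    ≡-trans (count-map b L (allFin n)) (≡-trans (count-cong _ long (allFin n) b∘L≗long) count-long)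
    where
    b∘L≗long : ∀ i → b (L i) ≡ long i
    b∘L≗long i with long i
    ... | true = b1
    ... | false = b¼

  L-cases : ∀ i → L i ≡ 1ℚ ⊎ L i ≡ ¼
  L-cases i with long i
  ... | true = inj₁ refl
  ... | false = inj₂ refl

  module _ (k≤n : k ≤ n) where
    k∸1⊓n≡k∸1 : (k ∸ 1) ⊓ n ≡ k ∸ 1
    k∸1⊓n≡k∸1 = ℕₚ.m≤n⇒m⊓n≡m (ℕₚ.≤-trans (ℕₚ.m∸n≤m k 1) k≤n)

    open KthLargest (Lco-kthLargest L k 1≤k k≤n)

    -- only k ∸ 1 lengths are ≥ 1, so the k-th largest one is not 1
    Lco≡¼ : Lco L k ≡ ¼
    Lco≡¼ with L-cases index
    ... | inj₂ L≡¼ = ≡-trans is-length L≡¼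
    ... | inj₁ L≡1 = ⊥-elim (ℕₚ.<⇒≱ (ℕₚ.∸-monoʳ-< {k} {1} {0} (s≤s z≤n) 1≤k) k≤k∸1)
      where
      k≤k∸1 : k ≤ k ∸ 1
      k≤k∸1 = subst (k ≤_)
        (≡-trans (cong (λ y → count (atLeast y) (lengths L)) (≡-trans is-length L≡1))
                 (≡-trans (count-separating (atLeast 1ℚ) refl refl) k∸1⊓n≡k∸1))
        atLeast-count

    ½>0 : 0ℚ ℚ.< ½
    ½>0 = toWitness {a? = 0ℚ ℚ.<? ½} tt

    -- every piece of length 1 yields two parts of length ½
    ½-feasible : Feasible L k ½
    ½-feasible = ½>0 , ℤₚ.≤-trans (ℤ.+≤+ k≤2*count)
      (*count≤sumℤ 2 long (λ i → ℚ.floor (L i ÷? ½)) (allFin n) 2≤floor (floor÷?-nonNeg L>0 ½>0))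
      where
      k≤2*count : k ≤ 2 * count long (allFin n)
      k≤2*count = subst (λ c → k ≤ 2 * c) (sym (≡-trans count-long k∸1⊓n≡k∸1)) (k≤2*[k∸1] 2≤k)
      2≤floor : ∀ i → T (long i) → + 2 ℤ.≤ ℚ.floor (L i ÷? ½)
      2≤floor i long-i with long i
      ... | true = fromℕ*≤⇒≤floor÷? ½>0 2 1ℚ (toWitness {a? = fromℕ 2 ℚ.* ½ ℚ.≤? 1ℚ} tt)

  module _ (k≰n : ¬ k ≤ n) where
    k∸1⊓n≡n : (k ∸ 1) ⊓ n ≡ n
    k∸1⊓n≡n = ℕₚ.m≥n⇒m⊓n≡n (ℕₚ.<⇒≤pred (ℕₚ.≰⇒> k≰n))

  count-above-Lco : count (above (Lco L k)) (lengths L) ≡ (k ∸ 1) ⊓ n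
  count-above-Lco =
    [ (λ k≤n → ≡-trans (cong (λ y → count (above y) (lengths L)) (Lco≡¼ k≤n)) (count-separating (above ¼) refl refl))
    , (λ k≰n → begin
        count (above (Lco L k)) (lengths L)   ≡⟨ cong (λ y → count (above y) (lengths L)) (Lco-> L k k≰n) ⟩
        count (above 0ℚ) (lengths L)           ≡⟨ count-all (above 0ℚ) (lengths L) all-above-0 ⟩
        length (lengths L)                     ≡⟨ length-lengths L ⟩
        n                                      ≡⟨ sym (k∸1⊓n≡n k≰n) ⟩
        (k ∸ 1) ⊓ n                            ∎)
    ]′ (toSum (k ℕ.≤? n))
    where
    open ≡-Reasoning
    all-above-0 : All (λ x → T (above 0ℚ x)) (lengths L)
    all-above-0 = Allₚ.map⁺ (All.universal (λ i → fromWitness (L>0 i)) (allFin n))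

  Lco≢l⋆ : ∀ l⋆ → IsLStar L k l⋆ → Lco L k ≢ l⋆
  Lco≢l⋆ l⋆ l⋆-max = ℚₚ.<⇒≢
    ([ (λ k≤n → subst (ℚ._< l⋆) (sym (Lco≡¼ k≤n)) (¼<l⋆ k≤n))
     , (λ k≰n → subst (ℚ._< l⋆) (sym (Lco-> L k k≰n)) (proj₁ (proj₁ l⋆-max)))
     ]′ (toSum (k ℕ.≤? n)))
    where
    ¼<l⋆ : k ≤ n → ¼ ℚ.< l⋆
    ¼<l⋆ k≤n = ℚₚ.<-≤-trans (toWitness {a? = ¼ ℚ.<? ½} tt) (proj₂ l⋆-max ½ (½-feasible k≤n))

worst-case : ∀ n k → 2 ≤ k → ∃[ L ] (Positive {n} L × (∀ l⋆ → IsLStar L k l⋆ → Lco L k ≢ l⋆)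
             × length (C L (Ico L k) (λ _ → 1) (λ _ → k)) ≡ k * ((k ∸ 1) ⊓ n))
worst-case n k 2≤k = L , L>0 , Lco≢l⋆
  , ≡-trans (length-C-const L (Ico L k) 1 k) (cong (k *_) (≡-trans (count-Ico L k) count-above-Lco))
  where open WorstCase n k 2≤k

k*[k∸1⊓n]≤k*[k⊓n] : ∀ n k → k * ((k ∸ 1) ⊓ n) ≤ k * (k ⊓ n)
k*[k∸1⊓n]≤k*[k⊓n] n k = ℕₚ.*-monoʳ-≤ k (ℕₚ.⊓-monoˡ-≤ n (ℕₚ.m∸n≤m k 1))

k⊓n≤2*[k∸1⊓n] : ∀ n k → 2 ≤ k → k ⊓ n ≤ 2 * ((k ∸ 1) ⊓ n)
k⊓n≤2*[k∸1⊓n] n k 2≤k with ℕₚ.≤-total n (k ∸ 1)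
... | inj₁ n≤k∸1 = subst₂ _≤_ (sym (ℕₚ.m≥n⇒m⊓n≡n (ℕₚ.≤-trans n≤k∸1 (ℕₚ.m∸n≤m k 1))))
                              (cong (2 *_) (sym (ℕₚ.m≥n⇒m⊓n≡n n≤k∸1))) (ℕₚ.m≤n*m n 2)
... | inj₂ k∸1≤n = ℕₚ.≤-trans (ℕₚ.m⊓n≤m k n)
                     (subst (λ c → k ≤ 2 * c) (sym (ℕₚ.m≤n⇒m⊓n≡m k∸1≤n)) (k≤2*[k∸1] 2≤k))

k*[k⊓n]≤2*k*[k∸1⊓n] : ∀ n k → 2 ≤ k → k * (k ⊓ n) ≤ 2 * (k * ((k ∸ 1) ⊓ n))
k*[k⊓n]≤2*k*[k∸1⊓n] n k 2≤k = begin
  k * (k ⊓ n)                  ≤⟨ ℕₚ.*-monoʳ-≤ k (k⊓n≤2*[k∸1⊓n] n k 2≤k) ⟩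
  k * (2 * ((k ∸ 1) ⊓ n))      ≡⟨ ℕₚ.*-comm k (2 * ((k ∸ 1) ⊓ n)) ⟩
  2 * ((k ∸ 1) ⊓ n) * k        ≡⟨ ℕₚ.*-assoc 2 ((k ∸ 1) ⊓ n) k ⟩
  2 * ((k ∸ 1) ⊓ n * k)        ≡⟨ cong (2 *_) (ℕₚ.*-comm ((k ∸ 1) ⊓ n) k) ⟩
  2 * (k * ((k ∸ 1) ⊓ n))      ∎
  where open ℕₚ.≤-Reasoning

lemma5 : (∀ (n k : ℕ) → 1 ≤ k → (L : Fin n → ℚ) → Positive L →
    (l⋆ : ℚ) → IsLStar L k l⋆ → Lco L k ≢ l⋆ →
    Admissible L k (Ico L k) (λ _ → 1) (λ _ → fin k)
    × l⋆ ∈ C L (Ico L k) (λ _ → 1) (λ _ → k))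
    × (∀ (n k : ℕ) → 1 ≤ k →
    (∀ (L : Fin n → ℚ) → Positive L → (l⋆ : ℚ) → IsLStar L k l⋆ → Lco L k ≢ l⋆ →
    length (C L (Ico L k) (λ _ → 1) (λ _ → k)) ≤ k * ((k ∸ 1) ⊓ n))
    × (2 ≤ k → ∃[ L ] (Positive {n} L × (∀ l⋆ → IsLStar L k l⋆ → Lco L k ≢ l⋆)
    × length (C L (Ico L k) (λ _ → 1) (λ _ → k)) ≡ k * ((k ∸ 1) ⊓ n))))
    × ((∀ (n k : ℕ) → k * ((k ∸ 1) ⊓ n) ≤ k * (k ⊓ n))
    × ∃[ c ] ∃[ k₀ ] (∀ (n k : ℕ) → k₀ ≤ k → k * (k ⊓ n) ≤ c * (k * ((k ∸ 1) ⊓ n))))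
lemma5 =
    (λ n k 1≤k L L>0 l⋆ l⋆-max Lco≢l⋆ →
       Ico-admissible 1≤k L>0 l⋆-max Lco≢l⋆ , l⋆∈C 1≤k L>0 l⋆-max Lco≢l⋆)
  , (λ n k 1≤k → (λ L _ _ _ _ → length-C-Ico≤ L k 1≤k) , worst-case n k)
  , k*[k∸1⊓n]≤k*[k⊓n]
  , (2 , 2 , k*[k⊓n]≤2*k*[k∸1⊓n])
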